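{- Let $A$ and $B$ be elements of a commutative ring $R$ with identity. For any integer $n>1$, $$\det[u_{|j-k+1|}(A,B)]_{1\le j,k\le n}=(B+1)^{n-2}$$ and $$\det[v_{|j-k+1|}(A,B)]_{1\le j,k\le n}=(4B-A^2)\big(A(B-1)\big)^{n-2}.$$
   Context: For elements $x,y$ of a commutative ring with identity, the Lucas sequences are defined by $u_0(x,y)=0$, $u_1(x,y)=1$, $v_0(x,y)=2$, $v_1(x,y)=x$, and $u_{n+1}(x,y)=xu_n(x,y)-yu_{n-1}(x,y)$, $v_{n+1}(x,y)=xv_n(x,y)-yv_{n-1}(x,y)$ for $n\ge1$. The convention $0^0=1$ is used. -}

module Defs where

open import Level using (Level)
open import Algebra.Bundles using (CommutativeRing)
open import Data.Nat using (ℕ; zero; suc) renaming (_+_ to _+ℕ_)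
open import Data.Nat.Base using (∣_-_∣)
open import Data.Fin using (Fin; zero; suc; toℕ; punchIn)

module LucasDet {c ℓ : Level} (R : CommutativeRing c ℓ) where
  open CommutativeRing R using (Carrier; _+_; _*_; -_; _-_; 0#; 1#)

  pow : Carrier → ℕ → Carrier
  pow x zero    = 1#
  pow x (suc n) = x * pow x n

  lucasU : Carrier → Carrier → ℕ → Carrier
  lucasU x y zero          = 0#
  lucasU x y (suc zero)    = 1#
  lucasU x y (suc (suc n)) = x * lucasU x y (suc n) - y * lucasU x y n

  lucasV : Carrier → Carrier → ℕ → Carrier
  lucasV x y zero          = 1# + 1#
  lucasV x y (suc zero)    = x
  lucasV x y (suc (suc n)) = x * lucasV x y (suc n) - y * lucasV x y n

  sumFin : (n : ℕ) → (Fin n → Carrier) → Carrier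
  sumFin zero    f = 0#
  sumFin (suc n) f = f zero + sumFin n (λ i → f (suc i))

  sign : ℕ → Carrier
  sign zero    = 1#
  sign (suc i) = - sign i

  det : (n : ℕ) → (Fin n → Fin n → Carrier) → Carrier
  det zero    M = 1#
  det (suc n) M =
    sumFin (suc n) (λ i → sign (toℕ i) * (M i zero * det n (λ j k → M (punchIn i j) (suc k))))

  -- the n×n matrix [w_{|j-k+1|}]_{1≤j,k≤n}; with 0-based indices j,k
  -- the quantity |j-k+1| is unchanged
  toeplitz : (n : ℕ) → (ℕ → Carrier) → Fin n → Fin n → Carrier
  toeplitz n w j k = w ∣ toℕ j +ℕ 1 - toℕ k ∣

-- Let w be u or v, so that w (n+2) − A w (n+1) + B w n = 0. Replacing every row j ≥ 2 (counting from 0)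
-- of [w |j−k+1|] by row j − A · row (j−1) + B · row (j−2), bottom-up, does not change the determinant,
-- since the determinant is multilinear and alternating in the rows. By the recurrence the new rows vanish
-- left of the diagonal and carry d = w 1 − A w 0 + B w 1 on it, so expanding along the first column, whose
-- only nonzero entries are now w 1 and w 2, leaves two triangular minors and
-- det = (w 1 ² − w 2 w 0) d ^ (n−2). For u this is (B + 1) ^ (n−2); for v, with w 0 = 2, w 1 = A and
-- w 2 = A² − 2B, it is (4B − A²) (A (B − 1)) ^ (n−2).

module Submission where

open import Defs
open import Level using (Level)
open import Algebra.Bundles using (CommutativeRing)
import Algebra.Properties.AbelianGroup as AbelianGroupProperties
import Algebra.Properties.CommutativeSemigroup as CommutativeSemigroupProperties
import Algebra.Properties.Ring as RingProperties
import Algebra.Properties.Semiring.Mult.TCOptimised as SemiringMultiplication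
import Algebra.Solver.Ring
import Algebra.Solver.Ring.AlmostCommutativeRing as ACR
open import Data.Fin.Base using (Fin; zero; suc; toℕ; punchIn; punchOut; inject₁; fromℕ<)
import Data.Fin.Properties as Fin
open import Data.Integer.Base as ℤ using (ℤ; +_; -[1+_]; _⊖_)
import Data.Integer.Properties as ℤ
open import Data.Maybe.Base using (Maybe; just; nothing)
open import Data.Nat.Base as ℕ using (ℕ; zero; suc; ∣_-_∣)
import Data.Nat.Properties as ℕ
open import Data.Product.Base using (_×_; _,_)
open import Data.Vec.Functional using (updateAt)
import Data.Vec.Functional.Properties as Vector
open import Function.Base using (_∘_)
open import Relation.Nullary.Decidable using (yes; no)
open import Relation.Nullary.Negation using (contradiction)
open import Relation.Binary.PropositionalEquality as ≡ using (_≡_; _≢_)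
import Relation.Binary.Reasoning.Setoid as SetoidReasoning

-- Identities such as x − x ≈ 0 need coefficients that cancel, so the ring solver is run with
-- integer coefficients through the canonical map ℤ → R.
module IntegerCoefficientSolver {c ℓ} (R : CommutativeRing c ℓ) where
  open CommutativeRing R
  open RingProperties ring using (-‿involutive; -‿distribˡ-*; -‿distribʳ-*; -0#≈0#)
  open AbelianGroupProperties +-abelianGroup using (⁻¹-∙-comm)
  open CommutativeSemigroupProperties +-commutativeSemigroup using (interchange)
  open SemiringMultiplication semiring using (1+×; ×-homo-+; ×1-homo-*) renaming (_×_ to _×′_)
  open SetoidReasoning setoid

  ⟦_⟧ℤ : ℤ → Carrier
  ⟦ + n ⟧ℤ      = n ×′ 1#
  ⟦ -[1+ n ] ⟧ℤ = - (suc n ×′ 1#)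

  [1+x]-[1+y]≈x-y : ∀ x y → (1# + x) - (1# + y) ≈ x - y
  [1+x]-[1+y]≈x-y x y = begin
    (1# + x) + - (1# + y)   ≈⟨ +-congˡ (⁻¹-∙-comm 1# y) ⟨
    (1# + x) + (- 1# + - y) ≈⟨ interchange 1# x (- 1#) (- y) ⟩
    (1# - 1#) + (x - y)     ≈⟨ +-congʳ (-‿inverseʳ 1#) ⟩
    0# + (x - y)            ≈⟨ +-identityˡ _ ⟩
    x - y                   ∎

  ⊖-homo : ∀ m n → ⟦ m ⊖ n ⟧ℤ ≈ m ×′ 1# - n ×′ 1#
  ⊖-homo m       zero    = sym (trans (+-congˡ -0#≈0#) (+-identityʳ _))
  ⊖-homo zero    (suc n) = sym (+-identityˡ _)
  ⊖-homo (suc m) (suc n) = begin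
    ⟦ suc m ⊖ suc n ⟧ℤ              ≡⟨ ≡.cong ⟦_⟧ℤ (ℤ.[1+m]⊖[1+n]≡m⊖n m n) ⟩
    ⟦ m ⊖ n ⟧ℤ                      ≈⟨ ⊖-homo m n ⟩
    m ×′ 1# - n ×′ 1#               ≈⟨ [1+x]-[1+y]≈x-y _ _ ⟨
    (1# + m ×′ 1#) - (1# + n ×′ 1#) ≈⟨ +-cong (1+× m 1#) (-‿cong (1+× n 1#)) ⟨
    suc m ×′ 1# - suc n ×′ 1#       ∎

  +-homo : ∀ i j → ⟦ i ℤ.+ j ⟧ℤ ≈ ⟦ i ⟧ℤ + ⟦ j ⟧ℤ
  +-homo (+ m)    (+ n)    = ×-homo-+ 1# m n
  +-homo (+ m)    -[1+ n ] = ⊖-homo m (suc n)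
  +-homo -[1+ m ] (+ n)    = trans (⊖-homo n (suc m)) (+-comm _ _)
  +-homo -[1+ m ] -[1+ n ] = begin
    - (suc (suc (m ℕ.+ n)) ×′ 1#)     ≡⟨ ≡.cong (λ k → - (suc k ×′ 1#)) (ℕ.+-suc m n) ⟨
    - ((suc m ℕ.+ suc n) ×′ 1#)       ≈⟨ -‿cong (×-homo-+ 1# (suc m) (suc n)) ⟩
    - (suc m ×′ 1# + suc n ×′ 1#)     ≈⟨ ⁻¹-∙-comm _ _ ⟨
    - (suc m ×′ 1#) + - (suc n ×′ 1#) ∎

  -‿homo : ∀ i → ⟦ ℤ.- i ⟧ℤ ≈ - ⟦ i ⟧ℤ
  -‿homo (+ zero)  = sym -0#≈0#
  -‿homo (+ suc n) = refl
  -‿homo -[1+ n ]  = sym (-‿involutive _)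

  pos-*-homo : ∀ m n → ⟦ + m ℤ.* + n ⟧ℤ ≈ m ×′ 1# * n ×′ 1#
  pos-*-homo m n = trans (reflexive (≡.cong ⟦_⟧ℤ (≡.sym (ℤ.pos-* m n)))) (×1-homo-* m n)

  *-homo : ∀ i j → ⟦ i ℤ.* j ⟧ℤ ≈ ⟦ i ⟧ℤ * ⟦ j ⟧ℤ
  *-homo (+ m)    (+ n)    = pos-*-homo m n
  *-homo -[1+ m ] (+ n)    = begin
    ⟦ ℤ.- + suc m ℤ.* + n ⟧ℤ   ≡⟨ ≡.cong ⟦_⟧ℤ (ℤ.neg-distribˡ-* (+ suc m) (+ n)) ⟨
    ⟦ ℤ.- (+ suc m ℤ.* + n) ⟧ℤ ≈⟨ -‿homo (+ suc m ℤ.* + n) ⟩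
    - ⟦ + suc m ℤ.* + n ⟧ℤ     ≈⟨ -‿cong (pos-*-homo (suc m) n) ⟩
    - (suc m ×′ 1# * n ×′ 1#)  ≈⟨ -‿distribˡ-* _ _ ⟩
    - (suc m ×′ 1#) * n ×′ 1#  ∎
  *-homo (+ m)    -[1+ n ] = begin
    ⟦ + m ℤ.* ℤ.- + suc n ⟧ℤ   ≡⟨ ≡.cong ⟦_⟧ℤ (ℤ.neg-distribʳ-* (+ m) (+ suc n)) ⟨
    ⟦ ℤ.- (+ m ℤ.* + suc n) ⟧ℤ ≈⟨ -‿homo (+ m ℤ.* + suc n) ⟩
    - ⟦ + m ℤ.* + suc n ⟧ℤ     ≈⟨ -‿cong (pos-*-homo m (suc n)) ⟩
    - (m ×′ 1# * suc n ×′ 1#)  ≈⟨ -‿distribʳ-* _ _ ⟩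
    m ×′ 1# * - (suc n ×′ 1#)  ∎
  *-homo -[1+ m ] -[1+ n ] = begin
    ⟦ + suc m ℤ.* + suc n ⟧ℤ                ≈⟨ pos-*-homo (suc m) (suc n) ⟩
    suc m ×′ 1# * suc n ×′ 1#               ≈⟨ *-cong (-‿involutive _) (-‿involutive _) ⟨
    - - (suc m ×′ 1#) * - - (suc n ×′ 1#)   ≈⟨ -‿distribˡ-* _ _ ⟨
    - (- (suc m ×′ 1#) * - - (suc n ×′ 1#)) ≈⟨ -‿cong (-‿distribʳ-* _ _) ⟨
    - - (- (suc m ×′ 1#) * - (suc n ×′ 1#)) ≈⟨ -‿involutive _ ⟩
    - (suc m ×′ 1#) * - (suc n ×′ 1#)       ∎

  ℤ-homomorphism : ℤ.+-*-rawRing ACR.-Raw-AlmostCommutative⟶ ACR.fromCommutativeRing R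
  ℤ-homomorphism = record
    { ⟦_⟧ = ⟦_⟧ℤ ; +-homo = +-homo ; *-homo = *-homo ; -‿homo = -‿homo
    ; 0-homo = refl ; 1-homo = refl }

  ⟦⟧ℤ-weaklyDecidable : ∀ i j → Maybe (⟦ i ⟧ℤ ≈ ⟦ j ⟧ℤ)
  ⟦⟧ℤ-weaklyDecidable i j with i ℤ.≟ j
  ... | yes ≡.refl = just refl
  ... | no _       = nothing

  open Algebra.Solver.Ring ℤ.+-*-rawRing (ACR.fromCommutativeRing R) ℤ-homomorphism ⟦⟧ℤ-weaklyDecidable public


swapAdjacent : ∀ {n} → Fin n → Fin (suc n) → Fin (suc n)
swapAdjacent zero    zero          = suc zero
swapAdjacent zero    (suc zero)    = zero
swapAdjacent zero    (suc (suc i)) = suc (suc i)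
swapAdjacent (suc p) zero          = zero
swapAdjacent (suc p) (suc i)       = suc (swapAdjacent p i)

swapAdjacent-inject₁ : ∀ {n} (p : Fin n) → swapAdjacent p (inject₁ p) ≡ suc p
swapAdjacent-inject₁ zero    = ≡.refl
swapAdjacent-inject₁ (suc p) = ≡.cong suc (swapAdjacent-inject₁ p)

swapAdjacent-suc : ∀ {n} (p : Fin n) → swapAdjacent p (suc p) ≡ inject₁ p
swapAdjacent-suc zero    = ≡.refl
swapAdjacent-suc (suc p) = ≡.cong suc (swapAdjacent-suc p)

swapAdjacent-fix : ∀ {n} (p : Fin n) i → i ≢ inject₁ p → i ≢ suc p → swapAdjacent p i ≡ i
swapAdjacent-fix zero    zero          i≢p _     = contradiction ≡.refl i≢p
swapAdjacent-fix zero    (suc zero)    _   i≢1+p = contradiction ≡.refl i≢1+p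
swapAdjacent-fix zero    (suc (suc i)) _   _     = ≡.refl
swapAdjacent-fix (suc p) zero          _   _     = ≡.refl
swapAdjacent-fix (suc p) (suc i)       i≢p i≢1+p =
  ≡.cong suc (swapAdjacent-fix p i (i≢p ∘ ≡.cong suc) (i≢1+p ∘ ≡.cong suc))

swapAdjacent-punchIn-inject₁ : ∀ {n} (p : Fin n) j → swapAdjacent p (punchIn (inject₁ p) j) ≡ punchIn (suc p) j
swapAdjacent-punchIn-inject₁ zero    zero    = ≡.refl
swapAdjacent-punchIn-inject₁ zero    (suc j) = ≡.refl
swapAdjacent-punchIn-inject₁ (suc p) zero    = ≡.refl
swapAdjacent-punchIn-inject₁ (suc p) (suc j) = ≡.cong suc (swapAdjacent-punchIn-inject₁ p j)

swapAdjacent-punchIn-suc : ∀ {n} (p : Fin n) j → swapAdjacent p (punchIn (suc p) j) ≡ punchIn (inject₁ p) j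
swapAdjacent-punchIn-suc zero    zero    = ≡.refl
swapAdjacent-punchIn-suc zero    (suc j) = ≡.refl
swapAdjacent-punchIn-suc (suc p) zero    = ≡.refl
swapAdjacent-punchIn-suc (suc p) (suc j) = ≡.cong suc (swapAdjacent-punchIn-suc p j)

-- Deleting a row i outside the swapped pair turns the swap into an adjacent swap q of the remaining rows.
record PunchedSwap {n} (p : Fin (suc n)) (i : Fin (suc (suc n))) : Set where
  field
    q               : Fin n
    swap-punchIn    : ∀ j → swapAdjacent p (punchIn i j) ≡ punchIn i (swapAdjacent q j)
    punchIn-inject₁ : punchIn i (inject₁ q) ≡ inject₁ p
    punchIn-suc     : punchIn i (suc q) ≡ suc p

punchedSwap : ∀ {n} (p : Fin (suc n)) i → i ≢ inject₁ p → i ≢ suc p → PunchedSwap p i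
punchedSwap zero zero i≢p _ = contradiction ≡.refl i≢p
punchedSwap zero (suc zero) _ i≢1+p = contradiction ≡.refl i≢1+p
punchedSwap {suc n} zero (suc (suc i)) _ _ = record
  { q = zero ; swap-punchIn = commute ; punchIn-inject₁ = ≡.refl ; punchIn-suc = ≡.refl }
  where
  commute : ∀ j → swapAdjacent zero (punchIn (suc (suc i)) j) ≡ punchIn (suc (suc i)) (swapAdjacent zero j)
  commute zero          = ≡.refl
  commute (suc zero)    = ≡.refl
  commute (suc (suc j)) = ≡.refl
punchedSwap (suc p) zero _ _ = record
  { q = p ; swap-punchIn = λ _ → ≡.refl ; punchIn-inject₁ = ≡.refl ; punchIn-suc = ≡.refl }
punchedSwap {suc n} (suc p) (suc i) i≢p i≢1+p = record
  { q               = suc q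
  ; swap-punchIn    = commute
  ; punchIn-inject₁ = ≡.cong suc punchIn-inject₁
  ; punchIn-suc     = ≡.cong suc punchIn-suc
  }
  where
  open PunchedSwap (punchedSwap p i (i≢p ∘ ≡.cong suc) (i≢1+p ∘ ≡.cong suc))
  commute : ∀ j → swapAdjacent (suc p) (punchIn (suc i) j) ≡ punchIn (suc i) (swapAdjacent (suc q) j)
  commute zero    = ≡.refl
  commute (suc j) = ≡.cong suc (swap-punchIn j)

inject₁≢suc : ∀ {n} (i : Fin n) → inject₁ i ≢ suc i
inject₁≢suc zero    ()
inject₁≢suc (suc i) = inject₁≢suc i ∘ Fin.suc-injective

inject₁²≢suc² : ∀ {n} (i : Fin n) → inject₁ (inject₁ i) ≢ suc (suc i)
inject₁²≢suc² zero    ()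
inject₁²≢suc² (suc i) = inject₁²≢suc² i ∘ Fin.suc-injective

∣1+m-n∣≡1+∣m-n∣ : ∀ {m n} → n ℕ.≤ m → ∣ suc m - n ∣ ≡ suc ∣ m - n ∣
∣1+m-n∣≡1+∣m-n∣ {zero}  ℕ.z≤n       = ≡.refl
∣1+m-n∣≡1+∣m-n∣ {suc m} ℕ.z≤n       = ≡.refl
∣1+m-n∣≡1+∣m-n∣         (ℕ.s≤s n≤m) = ∣1+m-n∣≡1+∣m-n∣ n≤m

module DeterminantProperties {c ℓ} (R : CommutativeRing c ℓ) where
  open CommutativeRing R hiding (zero)
  open LucasDet R
  open RingProperties ring using (-‿involutive; -‿distribˡ-*; -‿distribʳ-*; -0#≈0#)
  open AbelianGroupProperties +-abelianGroup using (⁻¹-∙-comm)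
  open CommutativeSemigroupProperties +-commutativeSemigroup using (interchange; x∙yz≈y∙xz)
  open IntegerCoefficientSolver R using (solve; _:=_; _:+_; _:*_; _:-_; :-_; con)
  open SetoidReasoning setoid

  pow-cong : ∀ {x y} n → x ≈ y → pow x n ≈ pow y n
  pow-cong zero    x≈y = refl
  pow-cong (suc n) x≈y = *-cong x≈y (pow-cong n x≈y)

  sumFin-cong : ∀ n {f g : Fin n → Carrier} → (∀ i → f i ≈ g i) → sumFin n f ≈ sumFin n g
  sumFin-cong zero    f≈g = refl
  sumFin-cong (suc n) f≈g = +-cong (f≈g zero) (sumFin-cong n (f≈g ∘ suc))

  sumFin-zero : ∀ n {f : Fin n → Carrier} → (∀ i → f i ≈ 0#) → sumFin n f ≈ 0#
  sumFin-zero zero    f≈0 = refl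
  sumFin-zero (suc n) f≈0 = trans (+-cong (f≈0 zero) (sumFin-zero n (f≈0 ∘ suc))) (+-identityˡ 0#)

  sumFin-distrib-+ : ∀ n (f g : Fin n → Carrier) → sumFin n (λ i → f i + g i) ≈ sumFin n f + sumFin n g
  sumFin-distrib-+ zero    f g = sym (+-identityˡ 0#)
  sumFin-distrib-+ (suc n) f g =
    trans (+-congˡ (sumFin-distrib-+ n (f ∘ suc) (g ∘ suc))) (interchange _ _ _ _)

  *-distribˡ-sumFin : ∀ n x (f : Fin n → Carrier) → sumFin n (λ i → x * f i) ≈ x * sumFin n f
  *-distribˡ-sumFin zero    x f = sym (zeroʳ x)
  *-distribˡ-sumFin (suc n) x f = trans (+-congˡ (*-distribˡ-sumFin n x (f ∘ suc))) (sym (distribˡ x _ _))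

  -‿distrib-sumFin : ∀ n (f : Fin n → Carrier) → sumFin n (λ i → - f i) ≈ - sumFin n f
  -‿distrib-sumFin zero    f = sym -0#≈0#
  -‿distrib-sumFin (suc n) f = trans (+-congˡ (-‿distrib-sumFin n (f ∘ suc))) (⁻¹-∙-comm _ _)

  sumFin-swapAdjacent : ∀ n (p : Fin n) (f : Fin (suc n) → Carrier) → sumFin (suc n) (f ∘ swapAdjacent p) ≈ sumFin (suc n) f
  sumFin-swapAdjacent (suc n) zero    f = x∙yz≈y∙xz _ _ _
  sumFin-swapAdjacent (suc n) (suc p) f = +-congˡ (sumFin-swapAdjacent n p (f ∘ suc))

  sumFin-adjacentPair : ∀ n (p : Fin n) (f : Fin (suc n) → Carrier) →
                        (∀ i → i ≢ inject₁ p → i ≢ suc p → f i ≈ 0#) →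
                        sumFin (suc n) f ≈ f (inject₁ p) + f (suc p)
  sumFin-adjacentPair (suc n) zero    f rest≈0 =
    +-congˡ (trans (+-congˡ (sumFin-zero n (λ i → rest≈0 (suc (suc i)) (λ ()) (λ ())))) (+-identityʳ _))
  sumFin-adjacentPair (suc n) (suc p) f rest≈0 = begin
    f zero + sumFin (suc n) (f ∘ suc)        ≈⟨ +-cong (rest≈0 zero (λ ()) (λ ())) (sumFin-adjacentPair n p (f ∘ suc) rest′≈0) ⟩
    0# + (f (suc (inject₁ p)) + f (suc (suc p))) ≈⟨ +-identityˡ _ ⟩
    f (suc (inject₁ p)) + f (suc (suc p))    ∎
    where
    rest′≈0 : ∀ i → i ≢ inject₁ p → i ≢ suc p → f (suc i) ≈ 0#
    rest′≈0 i i≢p i≢1+p = rest≈0 (suc i) (i≢p ∘ Fin.suc-injective) (i≢1+p ∘ Fin.suc-injective)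

  Matrix : ℕ → Set c
  Matrix n = Fin n → Fin n → Carrier

  minor : ∀ {n} → Fin (suc n) → Matrix (suc n) → Matrix n
  minor i M j k = M (punchIn i j) (suc k)

  unsignedTerm : ∀ {n} → Matrix (suc n) → Fin (suc n) → Carrier
  unsignedTerm {n} M i = M i zero * det n (minor i M)

  expansionTerm : ∀ {n} → Matrix (suc n) → Fin (suc n) → Carrier
  expansionTerm M i = sign (toℕ i) * unsignedTerm M i

  expansionTerm-zeroEntry : ∀ {n} (M : Matrix (suc n)) i → M i zero ≈ 0# → expansionTerm M i ≈ 0#
  expansionTerm-zeroEntry M i entry≈0 = trans (*-congˡ (trans (*-congʳ entry≈0) (zeroˡ _))) (zeroʳ _)

  det-cong : ∀ n {M N : Matrix n} → (∀ i k → M i k ≈ N i k) → det n M ≈ det n N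
  det-cong zero    M≈N = refl
  det-cong (suc n) M≈N = sumFin-cong (suc n) λ i →
    *-congˡ {sign (toℕ i)} (*-cong (M≈N i zero) (det-cong n (λ j k → M≈N (punchIn i j) (suc k))))

  sign-inject₁ : ∀ {n} (p : Fin n) → sign (toℕ (inject₁ p)) ≡ sign (toℕ p)
  sign-inject₁ p = ≡.cong sign (Fin.toℕ-inject₁ p)

  unsignedTerm-reindex : ∀ {n} (M N : Matrix (suc n)) i i′ → M i ≡ N i′ → (∀ j → M (punchIn i j) ≡ N (punchIn i′ j)) →
                       unsignedTerm M i ≈ unsignedTerm N i′
  unsignedTerm-reindex {n} M N i i′ row minorRows =
    *-cong (reflexive (≡.cong-app row zero)) (det-cong n (λ j k → reflexive (≡.cong-app (minorRows j) (suc k))))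

  det-swapAdjacent : ∀ {n} (p : Fin n) (M : Matrix (suc n)) → det (suc n) (M ∘ swapAdjacent p) ≈ - det (suc n) M
  det-swapAdjacent {suc n} p M = begin
    sumFin (suc (suc n)) (expansionTerm (M ∘ swapAdjacent p))
      ≈⟨ sumFin-cong (suc (suc n)) swappedTerm ⟩
    sumFin (suc (suc n)) (λ i → - expansionTerm M (swapAdjacent p i))
      ≈⟨ -‿distrib-sumFin (suc (suc n)) (expansionTerm M ∘ swapAdjacent p) ⟩
    - sumFin (suc (suc n)) (expansionTerm M ∘ swapAdjacent p)
      ≈⟨ -‿cong (sumFin-swapAdjacent (suc n) p (expansionTerm M)) ⟩
    - det (suc (suc n)) M ∎
    where
    swappedTerm : ∀ i → expansionTerm (M ∘ swapAdjacent p) i ≈ - expansionTerm M (swapAdjacent p i)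
    swappedTerm i with i Fin.≟ inject₁ p | i Fin.≟ suc p
    ... | yes ≡.refl | _ = begin
      sign (toℕ (inject₁ p)) * unsignedTerm (M ∘ swapAdjacent p) (inject₁ p)
        ≈⟨ *-cong (reflexive (sign-inject₁ p))
                  (unsignedTerm-reindex (M ∘ swapAdjacent p) M (inject₁ p) (suc p)
                     (≡.cong M (swapAdjacent-inject₁ p)) (≡.cong M ∘ swapAdjacent-punchIn-inject₁ p)) ⟩
      sign (toℕ p) * unsignedTerm M (suc p)
        ≈⟨ solve 2 (λ s x → s :* x := :- ((:- s) :* x)) refl (sign (toℕ p)) (unsignedTerm M (suc p)) ⟩
      - expansionTerm M (suc p)
        ≡⟨ ≡.cong (λ r → - expansionTerm M r) (swapAdjacent-inject₁ p) ⟨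
      - expansionTerm M (swapAdjacent p (inject₁ p)) ∎
    ... | no _ | yes ≡.refl = begin
      - sign (toℕ p) * unsignedTerm (M ∘ swapAdjacent p) (suc p)
        ≈⟨ *-congˡ (unsignedTerm-reindex (M ∘ swapAdjacent p) M (suc p) (inject₁ p)
                      (≡.cong M (swapAdjacent-suc p)) (≡.cong M ∘ swapAdjacent-punchIn-suc p)) ⟩
      - sign (toℕ p) * unsignedTerm M (inject₁ p)
        ≈⟨ *-congʳ (-‿cong (reflexive (sign-inject₁ p))) ⟨
      - sign (toℕ (inject₁ p)) * unsignedTerm M (inject₁ p)
        ≈⟨ -‿distribˡ-* (sign (toℕ (inject₁ p))) (unsignedTerm M (inject₁ p)) ⟨
      - expansionTerm M (inject₁ p)
        ≡⟨ ≡.cong (λ r → - expansionTerm M r) (swapAdjacent-suc p) ⟨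
      - expansionTerm M (swapAdjacent p (suc p)) ∎
    ... | no i≢p | no i≢1+p = begin
      sign (toℕ i) * (M (swapAdjacent p i) zero * det (suc n) (minor i (M ∘ swapAdjacent p)))
        ≈⟨ *-congˡ (*-cong (reflexive (≡.cong (λ r → M r zero) fixed))
                           (det-cong (suc n) (λ j k → reflexive (≡.cong (λ r → M r (suc k)) (swap-punchIn j))))) ⟩
      sign (toℕ i) * (M i zero * det (suc n) (minor i M ∘ swapAdjacent q))
        ≈⟨ *-congˡ (*-congˡ (det-swapAdjacent q (minor i M))) ⟩
      sign (toℕ i) * (M i zero * - det (suc n) (minor i M))
        ≈⟨ solve 3 (λ s x d → s :* (x :* (:- d)) := :- (s :* (x :* d))) refl (sign (toℕ i)) (M i zero) (det (suc n) (minor i M)) ⟩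
      - expansionTerm M i
        ≡⟨ ≡.cong (λ r → - expansionTerm M r) fixed ⟨
      - expansionTerm M (swapAdjacent p i) ∎
      where
      fixed : swapAdjacent p i ≡ i
      fixed = swapAdjacent-fix p i i≢p i≢1+p
      open PunchedSwap (punchedSwap p i i≢p i≢1+p)

  swapAdjacent-equalRows : ∀ {n} (p : Fin n) (M : Matrix (suc n)) → (∀ k → M (inject₁ p) k ≈ M (suc p) k) →
                           ∀ i k → M (swapAdjacent p i) k ≈ M i k
  swapAdjacent-equalRows p M equal i k with i Fin.≟ inject₁ p | i Fin.≟ suc p
  ... | yes ≡.refl | _          = trans (reflexive (≡.cong (λ r → M r k) (swapAdjacent-inject₁ p))) (sym (equal k))
  ... | no _       | yes ≡.refl = trans (reflexive (≡.cong (λ r → M r k) (swapAdjacent-suc p))) (equal k)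
  ... | no i≢p     | no i≢1+p   = reflexive (≡.cong (λ r → M r k) (swapAdjacent-fix p i i≢p i≢1+p))

  det-adjacentEqualRows : ∀ {n} (p : Fin n) (M : Matrix (suc n)) → (∀ k → M (inject₁ p) k ≈ M (suc p) k) →
                          det (suc n) M ≈ 0#
  det-adjacentEqualRows {suc n} p M equal = begin
    det (suc (suc n)) M
      ≈⟨ sumFin-adjacentPair (suc n) p (expansionTerm M) otherTerm≈0 ⟩
    expansionTerm M (inject₁ p) + expansionTerm M (suc p)
      ≈⟨ +-cong (*-congʳ (reflexive (sign-inject₁ p))) (*-congˡ pairTerms) ⟩
    sign (toℕ p) * unsignedTerm M (inject₁ p) + - sign (toℕ p) * unsignedTerm M (inject₁ p)
      ≈⟨ solve 2 (λ s x → s :* x :+ (:- s) :* x := con (+ 0)) refl (sign (toℕ p)) (unsignedTerm M (inject₁ p)) ⟩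
    0# ∎
    where
    otherTerm≈0 : ∀ i → i ≢ inject₁ p → i ≢ suc p → expansionTerm M i ≈ 0#
    otherTerm≈0 i i≢p i≢1+p = begin
      sign (toℕ i) * (M i zero * det (suc n) (minor i M)) ≈⟨ *-congˡ (*-congˡ (det-adjacentEqualRows q (minor i M) minorEqual)) ⟩
      sign (toℕ i) * (M i zero * 0#)                      ≈⟨ trans (*-congˡ (zeroʳ _)) (zeroʳ _) ⟩
      0#                                                  ∎
      where
      open PunchedSwap (punchedSwap p i i≢p i≢1+p)
      minorEqual : ∀ k → minor i M (inject₁ q) k ≈ minor i M (suc q) k
      minorEqual k = begin
        M (punchIn i (inject₁ q)) (suc k) ≡⟨ ≡.cong (λ r → M r (suc k)) punchIn-inject₁ ⟩
        M (inject₁ p) (suc k)             ≈⟨ equal (suc k) ⟩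
        M (suc p) (suc k)                 ≡⟨ ≡.cong (λ r → M r (suc k)) punchIn-suc ⟨
        M (punchIn i (suc q)) (suc k)     ∎
    pairTerms : unsignedTerm M (suc p) ≈ unsignedTerm M (inject₁ p)
    pairTerms = *-cong (sym (equal zero)) (det-cong (suc n) λ j k → begin
      M (punchIn (suc p) j) (suc k)                        ≡⟨ ≡.cong (λ r → M r (suc k)) (swapAdjacent-punchIn-inject₁ p j) ⟨
      M (swapAdjacent p (punchIn (inject₁ p) j)) (suc k)   ≈⟨ swapAdjacent-equalRows p M equal _ (suc k) ⟩
      M (punchIn (inject₁ p) j) (suc k)                    ∎)

  -- Swapping rows p+1 and p+2 makes the equal rows p and p+2 adjacent.
  det-equalRowsTwoApart : ∀ {n} (p : Fin n) (M : Matrix (suc (suc n))) →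
                          (∀ k → M (inject₁ (inject₁ p)) k ≈ M (suc (suc p)) k) → det (suc (suc n)) M ≈ 0#
  det-equalRowsTwoApart {n} p M equal = begin
    det (suc (suc n)) M                               ≈⟨ -‿involutive _ ⟨
    - - det (suc (suc n)) M                           ≈⟨ -‿cong (det-swapAdjacent (suc p) M) ⟨
    - det (suc (suc n)) (M ∘ swapAdjacent (suc p))    ≈⟨ -‿cong (det-adjacentEqualRows (inject₁ p) (M ∘ swapAdjacent (suc p)) swappedEqual) ⟩
    - 0#                                              ≈⟨ -0#≈0# ⟩
    0#                                                ∎
    where
    swappedEqual : ∀ k → M (swapAdjacent (suc p) (inject₁ (inject₁ p))) k ≈ M (swapAdjacent (suc p) (suc (inject₁ p))) k
    swappedEqual k = begin
      M (swapAdjacent (suc p) (inject₁ (inject₁ p))) k ≡⟨ ≡.cong (λ r → M r k) (swapAdjacent-fix (suc p) _ (inject₁≢suc (inject₁ p)) (inject₁²≢suc² p)) ⟩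
      M (inject₁ (inject₁ p)) k                         ≈⟨ equal k ⟩
      M (suc (suc p)) k                                 ≡⟨ ≡.cong (λ r → M r k) (swapAdjacent-inject₁ (suc p)) ⟨
      M (swapAdjacent (suc p) (suc (inject₁ p))) k      ∎

  det-linearInRow : ∀ {n} (r : Fin n) a {M N L : Matrix n} →
                    (∀ i k → i ≢ r → M i k ≈ N i k) → (∀ i k → i ≢ r → M i k ≈ L i k) →
                    (∀ k → M r k ≈ N r k + a * L r k) → det n M ≈ det n N + a * det n L
  det-linearInRow {suc n} r a {M} {N} {L} M≈N M≈L rowR = begin
    sumFin (suc n) (expansionTerm M)                                 ≈⟨ sumFin-cong (suc n) linearTerm ⟩
    sumFin (suc n) (λ i → expansionTerm N i + a * expansionTerm L i) ≈⟨ sumFin-distrib-+ (suc n) (expansionTerm N) (λ i → a * expansionTerm L i) ⟩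
    det (suc n) N + sumFin (suc n) (λ i → a * expansionTerm L i)     ≈⟨ +-congˡ (*-distribˡ-sumFin (suc n) a (expansionTerm L)) ⟩
    det (suc n) N + a * det (suc n) L                                ∎
    where
    linearTerm : ∀ i → expansionTerm M i ≈ expansionTerm N i + a * expansionTerm L i
    linearTerm i with i Fin.≟ r
    ... | yes ≡.refl = begin
      s * (M i zero * det n (minor i M))               ≈⟨ *-congˡ (*-congʳ (rowR zero)) ⟩
      s * ((N i zero + a * L i zero) * det n (minor i M))
        ≈⟨ solve 5 (λ s x a y d → s :* ((x :+ a :* y) :* d) := s :* (x :* d) :+ a :* (s :* (y :* d))) refl s (N i zero) a (L i zero) _ ⟩
      s * (N i zero * det n (minor i M)) + a * (s * (L i zero * det n (minor i M)))
        ≈⟨ +-cong (*-congˡ (*-congˡ (det-cong n (λ j k → M≈N _ _ (Fin.punchInᵢ≢i i j)))))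
                  (*-congˡ (*-congˡ (*-congˡ (det-cong n (λ j k → M≈L _ _ (Fin.punchInᵢ≢i i j)))))) ⟩
      expansionTerm N i + a * expansionTerm L i        ∎
      where
      s : Carrier
      s = sign (toℕ i)
    ... | no i≢r = begin
      s * (M i zero * det n (minor i M))               ≈⟨ *-congˡ (*-congˡ minorLinear) ⟩
      s * (M i zero * (det n (minor i N) + a * det n (minor i L)))
        ≈⟨ solve 5 (λ s x a y d → s :* (x :* (y :+ a :* d)) := s :* (x :* y) :+ a :* (s :* (x :* d))) refl s (M i zero) a _ _ ⟩
      s * (M i zero * det n (minor i N)) + a * (s * (M i zero * det n (minor i L)))
        ≈⟨ +-cong (*-congˡ (*-congʳ (M≈N i zero i≢r))) (*-congˡ (*-congˡ (*-congʳ (M≈L i zero i≢r)))) ⟩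
      expansionTerm N i + a * expansionTerm L i        ∎
      where
      s : Carrier
      s = sign (toℕ i)
      r′ : Fin n
      r′ = punchOut i≢r
      punchIn≢r : ∀ j → j ≢ r′ → punchIn i j ≢ r
      punchIn≢r j j≢r′ eq = j≢r′ (Fin.punchIn-injective i j r′ (≡.trans eq (≡.sym (Fin.punchIn-punchOut i≢r))))
      minorLinear : det n (minor i M) ≈ det n (minor i N) + a * det n (minor i L)
      minorLinear = det-linearInRow r′ a
        (λ j k j≢r′ → M≈N _ _ (punchIn≢r j j≢r′)) (λ j k j≢r′ → M≈L _ _ (punchIn≢r j j≢r′))
        (λ k → ≡.subst (λ row → M row (suc k) ≈ N row (suc k) + a * L row (suc k)) (≡.sym (Fin.punchIn-punchOut i≢r)) (rowR (suc k)))

  det-addRowMultiple : ∀ {n} {r s : Fin n} → s ≢ r → (∀ L → (∀ k → L s k ≈ L r k) → det n L ≈ 0#) →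
                       ∀ a {M N : Matrix n} → (∀ i k → i ≢ r → N i k ≈ M i k) →
                       (∀ k → N r k ≈ M r k + a * M s k) → det n N ≈ det n M
  det-addRowMultiple {n} {r} {s} s≢r alternating a {M} {N} N≈M rowR = begin
    det n N               ≈⟨ det-linearInRow r a N≈M (λ i k i≢r → trans (N≈M i k i≢r) (M≈L i≢r k))
                                                     (λ k → trans (rowR k) (+-congˡ (*-congˡ (Ms≈Lr k)))) ⟩
    det n M + a * det n L ≈⟨ +-congˡ (trans (*-congˡ (alternating L equalRows)) (zeroʳ a)) ⟩
    det n M + 0#          ≈⟨ +-identityʳ _ ⟩
    det n M               ∎
    where
    L : Matrix n
    L = updateAt M r (λ _ → M s)
    M≈L : ∀ {i} → i ≢ r → ∀ k → M i k ≈ L i k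
    M≈L i≢r k = reflexive (≡.cong-app (≡.sym (Vector.updateAt-minimal _ r M i≢r)) k)
    Ms≈Lr : ∀ k → M s k ≈ L r k
    Ms≈Lr k = reflexive (≡.cong-app (≡.sym (Vector.updateAt-updates r M)) k)
    equalRows : ∀ k → L s k ≈ L r k
    equalRows k = trans (sym (M≈L s≢r k)) (Ms≈Lr k)

  combinedRow : ∀ {m} → Carrier → Carrier → Matrix (suc (suc m)) → Fin m → Fin (suc (suc m)) → Carrier
  combinedRow a b M p k = M (suc (suc p)) k + a * M (suc (inject₁ p)) k + b * M (inject₁ (inject₁ p)) k

  reduceRowsFrom : ∀ {m} → ℕ → Carrier → Carrier → Matrix (suc (suc m)) → Matrix (suc (suc m))
  reduceRowsFrom t a b M zero          = M zero
  reduceRowsFrom t a b M (suc zero)    = M (suc zero)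
  reduceRowsFrom t a b M (suc (suc p)) with t ℕ.≤? toℕ p
  ... | yes _ = combinedRow a b M p
  ... | no  _ = M (suc (suc p))

  module _ {m : ℕ} (a b : Carrier) (M : Matrix (suc (suc m))) where

    reduceRowsFrom-unreduced : ∀ t i → toℕ i ℕ.≤ suc t → reduceRowsFrom t a b M i ≡ M i
    reduceRowsFrom-unreduced t zero          _           = ≡.refl
    reduceRowsFrom-unreduced t (suc zero)    _           = ≡.refl
    reduceRowsFrom-unreduced t (suc (suc p)) (ℕ.s≤s p<t) with t ℕ.≤? toℕ p
    ... | yes t≤p = contradiction t≤p (ℕ.<⇒≱ p<t)
    ... | no  _   = ≡.refl

    reduceRowsFrom-reduced : ∀ t p → t ℕ.≤ toℕ p → reduceRowsFrom t a b M (suc (suc p)) ≡ combinedRow a b M p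
    reduceRowsFrom-reduced t p t≤p with t ℕ.≤? toℕ p
    ... | yes _   = ≡.refl
    ... | no  t≰p = contradiction t≤p t≰p

    reduceRowsFrom-suc : ∀ t i → toℕ i ≢ suc (suc t) → reduceRowsFrom t a b M i ≡ reduceRowsFrom (suc t) a b M i
    reduceRowsFrom-suc t zero          _ = ≡.refl
    reduceRowsFrom-suc t (suc zero)    _ = ≡.refl
    reduceRowsFrom-suc t (suc (suc p)) i≢t with t ℕ.≤? toℕ p | suc t ℕ.≤? toℕ p
    ... | yes _   | yes _   = ≡.refl
    ... | no  _   | no  _   = ≡.refl
    ... | yes t≤p | no  t≮p = contradiction (ℕ.≤∧≢⇒< t≤p (i≢t ∘ ≡.cong (λ n → suc (suc n)) ∘ ≡.sym)) t≮p
    ... | no  t≰p | yes t<p = contradiction (ℕ.<⇒≤ t<p) t≰p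

    -- Lowering the threshold to p reduces row 2+p using rows p and 1+p, which are still unreduced,
    -- so the step is two row additions.
    det-reduceRowsFrom-step : ∀ (p : Fin m) →
      det (suc (suc m)) (reduceRowsFrom (toℕ p) a b M) ≈ det (suc (suc m)) (reduceRowsFrom (suc (toℕ p)) a b M)
    det-reduceRowsFrom-step p = begin
      det (suc (suc m)) N ≈⟨ det-addRowMultiple (inject₁²≢suc² p) (det-equalRowsTwoApart p) b N≈X rowN ⟩
      det (suc (suc m)) X ≈⟨ det-addRowMultiple (inject₁≢suc (suc p)) (det-adjacentEqualRows (suc p)) a X≈P rowX ⟩
      det (suc (suc m)) P ∎
      where
      t : ℕ
      t = toℕ p
      N P X : Matrix (suc (suc m))
      N = reduceRowsFrom t a b M
      P = reduceRowsFrom (suc t) a b M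
      r r₁ r₂ : Fin (suc (suc m))
      r  = suc (suc p)
      r₁ = suc (inject₁ p)
      r₂ = inject₁ (inject₁ p)
      X = updateAt P r (λ row k → row k + a * P r₁ k)
      P≡M : ∀ i → toℕ i ℕ.≤ suc (suc t) → ∀ k → P i k ≈ M i k
      P≡M i i≤t k = reflexive (≡.cong-app (reduceRowsFrom-unreduced (suc t) i i≤t) k)
      toℕ-r₂≡t : toℕ r₂ ≡ t
      toℕ-r₂≡t = ≡.trans (Fin.toℕ-inject₁ (inject₁ p)) (Fin.toℕ-inject₁ p)
      Pr≈Mr : ∀ k → P r k ≈ M r k
      Pr≈Mr = P≡M r ℕ.≤-refl
      Pr₁≈Mr₁ : ∀ k → P r₁ k ≈ M r₁ k
      Pr₁≈Mr₁ = P≡M r₁ (ℕ.s≤s (ℕ.≤-trans (ℕ.≤-reflexive (Fin.toℕ-inject₁ p)) (ℕ.n≤1+n t)))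
      Pr₂≈Mr₂ : ∀ k → P r₂ k ≈ M r₂ k
      Pr₂≈Mr₂ = P≡M r₂ (ℕ.≤-trans (ℕ.≤-reflexive toℕ-r₂≡t) (ℕ.m≤n+m t 2))
      X≈P : ∀ i k → i ≢ r → X i k ≈ P i k
      X≈P i k i≢r = reflexive (≡.cong-app (Vector.updateAt-minimal i r P i≢r) k)
      rowX : ∀ k → X r k ≈ P r k + a * P r₁ k
      rowX k = reflexive (≡.cong-app (Vector.updateAt-updates r P) k)
      N≈X : ∀ i k → i ≢ r → N i k ≈ X i k
      N≈X i k i≢r = trans (reflexive (≡.cong-app (reduceRowsFrom-suc t i (i≢r ∘ Fin.toℕ-injective)) k)) (sym (X≈P i k i≢r))
      rowN : ∀ k → N r k ≈ X r k + b * X r₂ k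
      rowN k = begin
        N r k                                    ≡⟨ ≡.cong-app (reduceRowsFrom-reduced t p ℕ.≤-refl) k ⟩
        M r k + a * M r₁ k + b * M r₂ k          ≈⟨ +-cong (+-cong (Pr≈Mr k) (*-congˡ (Pr₁≈Mr₁ k))) (*-congˡ (Pr₂≈Mr₂ k)) ⟨
        P r k + a * P r₁ k + b * P r₂ k          ≈⟨ +-cong (rowX k) (*-congˡ (X≈P r₂ k (inject₁²≢suc² p))) ⟨
        X r k + b * X r₂ k                       ∎

    det-reduceRowsFrom : ∀ s t → s ℕ.+ t ≡ m → det (suc (suc m)) (reduceRowsFrom t a b M) ≈ det (suc (suc m)) M
    det-reduceRowsFrom zero t ≡.refl = det-cong (suc (suc m)) λ i k →
      reflexive (≡.cong-app (reduceRowsFrom-unreduced t i (ℕ.s≤s⁻¹ (Fin.toℕ<n i))) k)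
    det-reduceRowsFrom (suc s) t s+1+t≡m = trans step (det-reduceRowsFrom s (suc t) (≡.trans (ℕ.+-suc s t) s+1+t≡m))
      where
      t<m : t ℕ.< m
      t<m = ℕ.≤-trans (ℕ.m≤n+m (suc t) s) (ℕ.≤-reflexive (≡.trans (ℕ.+-suc s t) s+1+t≡m))
      step : det (suc (suc m)) (reduceRowsFrom t a b M) ≈ det (suc (suc m)) (reduceRowsFrom (suc t) a b M)
      step = ≡.subst (λ t → det (suc (suc m)) (reduceRowsFrom t a b M) ≈ det (suc (suc m)) (reduceRowsFrom (suc t) a b M))
                     (Fin.toℕ-fromℕ< t<m) (det-reduceRowsFrom-step (fromℕ< t<m))

  det-reduceRows : ∀ {m} a b (M : Matrix (suc (suc m))) → det (suc (suc m)) (reduceRowsFrom 0 a b M) ≈ det (suc (suc m)) M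
  det-reduceRows {m} a b M = det-reduceRowsFrom a b M m 0 (ℕ.+-identityʳ m)

  productFin : (n : ℕ) → (Fin n → Carrier) → Carrier
  productFin zero    f = 1#
  productFin (suc n) f = f zero * productFin n (f ∘ suc)

  productFin-const : ∀ n {f : Fin n → Carrier} {x} → (∀ i → f i ≈ x) → productFin n f ≈ pow x n
  productFin-const zero    f≈x = refl
  productFin-const (suc n) f≈x = *-cong (f≈x zero) (productFin-const n (f≈x ∘ suc))

  det-upperTriangular : ∀ n (U : Matrix n) → (∀ i k → toℕ k ℕ.< toℕ i → U i k ≈ 0#) → det n U ≈ productFin n (λ i → U i i)
  det-upperTriangular zero    U lower≈0 = refl
  det-upperTriangular (suc n) U lower≈0 = begin
    1# * (U zero zero * det n (minor zero U)) + sumFin n (expansionTerm U ∘ suc)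
      ≈⟨ +-cong (*-identityˡ _) (sumFin-zero n (λ i → expansionTerm-zeroEntry U (suc i) (lower≈0 (suc i) zero ℕ.z<s))) ⟩
    U zero zero * det n (minor zero U) + 0#
      ≈⟨ trans (+-identityʳ _) (*-congˡ (det-upperTriangular n (minor zero U) (λ i k → lower≈0 (suc i) (suc k) ∘ ℕ.s≤s))) ⟩
    productFin (suc n) (λ i → U i i) ∎

  det-firstColumnTwoEntries : ∀ {m} (M : Matrix (suc (suc m))) → (∀ p → M (suc (suc p)) zero ≈ 0#) →
    det (suc (suc m)) M ≈ M zero zero * det (suc m) (minor zero M) - M (suc zero) zero * det (suc m) (minor (suc zero) M)
  det-firstColumnTwoEntries {m} M below≈0 = begin
    1# * unsignedTerm M zero + (- 1# * unsignedTerm M (suc zero) + sumFin m (λ p → expansionTerm M (suc (suc p))))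
      ≈⟨ +-congˡ (+-congˡ (sumFin-zero m (λ p → expansionTerm-zeroEntry M (suc (suc p)) (below≈0 p)))) ⟩
    1# * unsignedTerm M zero + (- 1# * unsignedTerm M (suc zero) + 0#)
      ≈⟨ solve 2 (λ x y → con (+ 1) :* x :+ (:- con (+ 1) :* y :+ con (+ 0)) := x :- y) refl (unsignedTerm M zero) (unsignedTerm M (suc zero)) ⟩
    unsignedTerm M zero - unsignedTerm M (suc zero) ∎

  module _ (A B : Carrier) (w : ℕ → Carrier) (recurrence : ∀ n → w (suc (suc n)) ≈ A * w (suc n) - B * w n) where

    entry : ℕ → ℕ → Carrier
    entry a κ = w ∣ suc a - κ ∣

    lucasCombination : ℕ → ℕ → Carrier
    lucasCombination a κ = entry (suc (suc a)) κ + - A * entry (suc a) κ + B * entry a κ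

    lucasCombination-vanishes : ∀ {a κ} → κ ℕ.≤ suc a → lucasCombination a κ ≈ 0#
    lucasCombination-vanishes {a} {κ} κ≤1+a = begin
      lucasCombination a κ                   ≡⟨ ≡.cong₂ (λ x y → w x + - A * w y + B * w n) ∣3+a-κ∣≡2+n ∣2+a-κ∣≡1+n ⟩
      w (suc (suc n)) + - A * w (suc n) + B * w n ≈⟨ +-congʳ (+-congʳ (recurrence n)) ⟩
      (A * w (suc n) - B * w n) + - A * w (suc n) + B * w n
        ≈⟨ solve 4 (λ a b x y → (a :* x :- b :* y) :+ (:- a) :* x :+ b :* y := con (+ 0)) refl A B (w (suc n)) (w n) ⟩
      0#                                     ∎
      where
      n : ℕ
      n = ∣ suc a - κ ∣
      ∣2+a-κ∣≡1+n : ∣ suc (suc a) - κ ∣ ≡ suc n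
      ∣2+a-κ∣≡1+n = ∣1+m-n∣≡1+∣m-n∣ κ≤1+a
      ∣3+a-κ∣≡2+n : ∣ suc (suc (suc a)) - κ ∣ ≡ suc (suc n)
      ∣3+a-κ∣≡2+n = ≡.trans (∣1+m-n∣≡1+∣m-n∣ (ℕ.m≤n⇒m≤1+n κ≤1+a)) (≡.cong suc ∣2+a-κ∣≡1+n)

    lucasCombination-diagonal : ∀ a → lucasCombination a (suc (suc a)) ≈ w 1 + - A * w 0 + B * w 1
    lucasCombination-diagonal a =
      +-cong (+-cong (reflexive (≡.cong w ∣1+a-a∣≡1)) (*-congˡ (reflexive (≡.cong w (ℕ.∣n-n∣≡0 a)))))
             (*-congˡ (reflexive (≡.cong w (≡.trans (ℕ.∣-∣-comm a (suc a)) ∣1+a-a∣≡1))))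
      where
      ∣1+a-a∣≡1 : ∣ suc a - a ∣ ≡ 1
      ∣1+a-a∣≡1 = ≡.trans (∣1+m-n∣≡1+∣m-n∣ {a} ℕ.≤-refl) (≡.cong suc (ℕ.∣n-n∣≡0 a))

    det-toeplitz-lucasRecurrence : ∀ m → det (suc (suc m)) (toeplitz (suc (suc m)) w)
                                           ≈ (w 1 * w 1 - w 2 * w 0) * pow (w 1 + - A * w 0 + B * w 1) m
    det-toeplitz-lucasRecurrence m = begin
      det (suc (suc m)) T                  ≈⟨ det-reduceRows (- A) B T ⟨
      det (suc (suc m)) T′                  ≈⟨ det-firstColumnTwoEntries T′ (λ p → T′-belowDiagonal p zero ℕ.z≤n) ⟩
      w 1 * det (suc m) (minor zero T′) - w 2 * det (suc m) (minor (suc zero) T′)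
        ≈⟨ +-cong (*-congˡ (det-minorOfT′ (minor zero T′) λ _ _ → ≡.refl))
                  (-‿cong (*-congˡ (det-minorOfT′ (minor (suc zero) T′) λ _ _ → ≡.refl))) ⟩
      w 1 * (w 1 * pow d m) - w 2 * (w 0 * pow d m)
        ≈⟨ solve 4 (λ x y z q → x :* (x :* q) :- y :* (z :* q) := (x :* x :- y :* z) :* q) refl (w 1) (w 2) (w 0) (pow d m) ⟩
      (w 1 * w 1 - w 2 * w 0) * pow d m    ∎
      where
      d : Carrier
      d = w 1 + - A * w 0 + B * w 1
      T T′ : Matrix (suc (suc m))
      T = toeplitz (suc (suc m)) w
      T′ = reduceRowsFrom 0 (- A) B T

      T-entry : ∀ i k {a} → toℕ i ≡ a → T i k ≈ entry a (toℕ k)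
      T-entry i k ≡.refl = reflexive (≡.cong (λ x → w ∣ x - toℕ k ∣) (ℕ.+-comm (toℕ i) 1))

      T′-combination : ∀ p k → T′ (suc (suc p)) k ≈ lucasCombination (toℕ p) (toℕ k)
      T′-combination p k =
        +-cong (+-cong (T-entry (suc (suc p)) k ≡.refl) (*-congˡ (T-entry (suc (inject₁ p)) k (≡.cong suc (Fin.toℕ-inject₁ p)))))
               (*-congˡ (T-entry (inject₁ (inject₁ p)) k (≡.trans (Fin.toℕ-inject₁ (inject₁ p)) (Fin.toℕ-inject₁ p))))

      T′-belowDiagonal : ∀ p k → toℕ k ℕ.≤ suc (toℕ p) → T′ (suc (suc p)) k ≈ 0#
      T′-belowDiagonal p k k≤1+p = trans (T′-combination p k) (lucasCombination-vanishes k≤1+p)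

      T′-diagonal : ∀ p → T′ (suc (suc p)) (suc (suc p)) ≈ d
      T′-diagonal p = trans (T′-combination p (suc (suc p))) (lucasCombination-diagonal (toℕ p))

      det-minorOfT′ : (U : Matrix (suc m)) → (∀ p k → U (suc p) k ≡ T′ (suc (suc p)) (suc k)) → det (suc m) U ≈ U zero zero * pow d m
      det-minorOfT′ U rows = begin
        det (suc m) U                          ≈⟨ det-upperTriangular (suc m) U upper ⟩
        U zero zero * productFin m (λ p → U (suc p) (suc p))
          ≈⟨ *-congˡ (productFin-const m (λ p → trans (reflexive (rows p (suc p))) (T′-diagonal p))) ⟩
        U zero zero * pow d m                  ∎
        where
        upper : ∀ i k → toℕ k ℕ.< toℕ i → U i k ≈ 0#
        upper (suc p) k k<1+p = trans (reflexive (rows p k)) (T′-belowDiagonal p (suc k) k<1+p)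

corollary1p9 : {c ℓ : Level} (R : CommutativeRing c ℓ) →
    let open CommutativeRing R
        open LucasDet R in
    (A B : Carrier) (m : ℕ) →
      (det (suc (suc m)) (toeplitz (suc (suc m)) (lucasU A B)) ≈ pow (B + 1#) m)
      × (det (suc (suc m)) (toeplitz (suc (suc m)) (lucasV A B))
           ≈ ((1# + 1# + 1# + 1#) * B - A * A) * pow (A * (B - 1#)) m)
corollary1p9 R A B m = lucasU-det , lucasV-det
  where
  open CommutativeRing R
  open LucasDet R
  open DeterminantProperties R using (det-toeplitz-lucasRecurrence; pow-cong)
  open IntegerCoefficientSolver R using (solve; _:=_; _:+_; _:*_; _:-_; :-_; con)
  open SetoidReasoning setoid

  lucasU-det : det (suc (suc m)) (toeplitz (suc (suc m)) (lucasU A B)) ≈ pow (B + 1#) m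
  lucasU-det = begin
    det (suc (suc m)) (toeplitz (suc (suc m)) (lucasU A B))  ≈⟨ det-toeplitz-lucasRecurrence A B (lucasU A B) (λ _ → refl) m ⟩
    (1# * 1# - (A * 1# - B * 0#) * 0#) * pow (1# + - A * 0# + B * 1#) m
      ≈⟨ *-cong (solve 2 (λ a b → con (+ 1) :* con (+ 1) :- (a :* con (+ 1) :- b :* con (+ 0)) :* con (+ 0) := con (+ 1)) refl A B)
                (pow-cong m (solve 2 (λ a b → con (+ 1) :+ (:- a) :* con (+ 0) :+ b :* con (+ 1) := b :+ con (+ 1)) refl A B)) ⟩
    1# * pow (B + 1#) m                                       ≈⟨ *-identityˡ _ ⟩
    pow (B + 1#) m                                            ∎

  lucasV-det : det (suc (suc m)) (toeplitz (suc (suc m)) (lucasV A B)) ≈ ((1# + 1# + 1# + 1#) * B - A * A) * pow (A * (B - 1#)) m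
  lucasV-det = begin
    det (suc (suc m)) (toeplitz (suc (suc m)) (lucasV A B))  ≈⟨ det-toeplitz-lucasRecurrence A B (lucasV A B) (λ _ → refl) m ⟩
    (A * A - (A * A - B * (1# + 1#)) * (1# + 1#)) * pow (A + - A * (1# + 1#) + B * A) m
      ≈⟨ *-cong (solve 2 (λ a b → a :* a :- (a :* a :- b :* (con (+ 1) :+ con (+ 1))) :* (con (+ 1) :+ con (+ 1))
                                  := (con (+ 1) :+ con (+ 1) :+ con (+ 1) :+ con (+ 1)) :* b :- a :* a) refl A B)
                (pow-cong m (solve 2 (λ a b → a :+ (:- a) :* (con (+ 1) :+ con (+ 1)) :+ b :* a := a :* (b :- con (+ 1))) refl A B)) ⟩
    ((1# + 1# + 1# + 1#) * B - A * A) * pow (A * (B - 1#)) m  ∎
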